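{- For every positive integer $n$, $$\Phi^{(4)}[aq^n; b; c, c'; x, y] = \sum_{k=0}^n \sum_{i=0}^k \begin{bmatrix} n \\ k \end{bmatrix} \begin{bmatrix} k \\ i \end{bmatrix} \frac{(b; q)_k}{(c; q)_{k-i} (c'; q)_i} q^{2\binom{k}{2}} a^k x^{k-i} y^i\, \Phi^{(4)}[aq^k; bq^k; cq^{k-i}, c'q^i; xq^i, y],$$ and $$\Phi^{(4)}[aq^{ -n}; b; c, c'; x, y] = \sum_{k=0}^n \sum_{i=0}^k \begin{bmatrix} n \\ k \end{bmatrix} \begin{bmatrix} k \\ i \end{bmatrix} \frac{(b; q)_k}{(c; q)_{k-i} (c'; q)_i} q^{\binom{k}{2} - nk} (-a)^k x^{k-i} y^i\, \Phi^{(4)}[a; bq^k; cq^{k-i}, c'q^i; xq^i, y].$$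
   Context: Let $q$ be a complex number with $|q|<1$. For a complex number $z$ and an integer $N\ge 0$, $(z;q)_N=\prod_{j=0}^{N-1}(1-zq^j)$. The $q$-binomial coefficient is $\begin{bmatrix} n \\ k \end{bmatrix}=\frac{(q;q)_n}{(q;q)_k(q;q)_{n-k}}$ for $0\le k\le n$, and $\binom{k}{2}=k(k-1)/2$. The $q$-Appell function $\Phi^{(4)}$ is $$\Phi^{(4)}[a; b; c, c'; x, y] = \sum_{m, n \geq 0} \frac{(a; q)_{m+n} (b; q)_{m+n}}{(q; q)_m (q; q)_n (c; q)_m (c'; q)_n} x^m y^n .$$ All identities are understood as identities of power series in $x,y$ (convergent for $|x|,|y|$ sufficiently small), with parameters generic so that no denominator appearing vanishes. -}

module Defs where

open import Level using (_⊔_; suc)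
open import Data.Nat as ℕ using (ℕ; zero; suc; _∸_; _≤?_)
open import Data.Product using (_×_)
open import Relation.Nullary using (¬_; yes; no)
open import Algebra.Bundles using (CommutativeRing)

record Field (c ℓ : Level.Level) : Set (Level.suc (c ⊔ ℓ)) where
  field
    commutativeRing : CommutativeRing c ℓ
  open CommutativeRing commutativeRing public
  field
    _⁻¹    : Carrier → Carrier
    0≉1    : ¬ (0# ≈ 1#)
    ⁻¹-inverse : ∀ x → ¬ (x ≈ 0#) → (x * (x ⁻¹)) ≈ 1#

module FieldDefs {c ℓ} (F : Field c ℓ) where
  open Field F using (Carrier; _≈_; _+_; _*_; _-_; 0#; 1#; _⁻¹)

  infixl 7 _/_
  _/_ : Carrier → Carrier → Carrier
  x / y = x * (y ⁻¹)

  _^_ : Carrier → ℕ → Carrier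
  x ^ zero  = 1#
  x ^ suc n = (x ^ n) * x

  poch : Carrier → Carrier → ℕ → Carrier
  poch z q zero    = 1#
  poch z q (suc N) = poch z q N * (1# - z * (q ^ N))

  qbinom : Carrier → ℕ → ℕ → Carrier
  qbinom q n k = poch q q n / (poch q q k * poch q q (n ∸ k))

  choose2 : ℕ → ℕ
  choose2 zero    = zero
  choose2 (suc k) = k ℕ.+ choose2 k

  Σ< : ℕ → (ℕ → Carrier) → Carrier
  Σ< zero    f = 0#
  Σ< (suc N) f = Σ< N f + f N

  -- Formal power series in two variables x, y: coefficient of x^m y^n.
  PS : Set c
  PS = ℕ → ℕ → Carrier

  _≈ₚ_ : PS → PS → Set ℓ
  f ≈ₚ g = ∀ m n → f m n ≈ g m n

  _·ₚ_ : Carrier → PS → PS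
  (s ·ₚ f) m n = s * f m n

  scaleX : Carrier → PS → PS
  scaleX s f m n = (s ^ m) * f m n

  -- multiplication by the monomial x^i y^j
  monoMul : ℕ → ℕ → PS → PS
  monoMul i j f m n with i ≤? m | j ≤? n
  ... | yes _ | yes _ = f (m ∸ i) (n ∸ j)
  ... | _     | _     = 0#

  Σₚ< : ℕ → (ℕ → PS) → PS
  Σₚ< N F m n = Σ< N (λ k → F k m n)

  Φ4 : (q a b c c' : Carrier) → PS
  Φ4 q a b c c' m n =
    (poch a q (m ℕ.+ n) * poch b q (m ℕ.+ n))
      / (poch q q m * poch q q n * poch c q m * poch c' q n)

module Submission where

-- Both identities are equalities of formal power series,
-- so it suffices to compare the coefficients of x^m y^n.  Write s = m + n,
-- ⟨s⟩_k = (1 - q^s)⋯(1 - q^{s-k+1}) = (q;q)_s/(q;q)_{s-k} for the q-falling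
-- factorial and [N, k] for the Gaussian binomial.  After extracting the
-- monomial x^{k-i} y^i, the (k, i) summand on the right has coefficient
--   common · [N, k] T_k A_k (A'_k; q)_{s-k} · [k, i] q^{i(m-k+i)} ⟨m⟩_{k-i} ⟨n⟩_i,
-- where common = (b;q)_s / ((q;q)_m (q;q)_n (c;q)_m (c';q)_n) is also the
-- factor in front of (A; q)_s on the left.  The inner sum over i collapses by a
-- q-Vandermonde identity for falling factorials (FallingVandermonde), and what
-- remains is one of two terminating q-binomial expansions of a Pochhammer
-- symbol (Expansions).  All three identities are proved by induction with the
-- q-Pascal recursion (GaussianBinomial), which is identified with the quotient
-- of q-Pochhammer symbols used in the statement using (q;q)_m ≠ 0.  Ring
-- normalisation throughout is done by the standard library's ring solver,
-- instantiated with integer coefficients for an arbitrary commutative ring.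

open import Defs
open import Level using (Level)
open import Data.Product using (_×_; _,_)
open import Data.Nat as ℕ using (ℕ; zero; suc; _∸_; _≤_; _<_; s≤s)
import Data.Nat.Properties as ℕP
open import Data.Integer as ℤ using (ℤ; +_; -[1+_]; +0; +[1+_]; _◃_; ∣_∣; sign)
import Data.Integer.Properties as ℤP
open import Data.Sign as Sign using (Sign)
open import Data.Maybe using (Maybe; just; nothing)
open import Data.Sum using (_⊎_; inj₁; inj₂)
open import Relation.Nullary using (¬_; yes; no)
open import Relation.Binary.PropositionalEquality as P using (_≡_)
open import Algebra.Bundles using (CommutativeRing; RawRing)
import Algebra.Solver.Ring.AlmostCommutativeRing as ACR
import Data.Nat.Tactic.RingSolver as ℕSolver

-- Integer coefficients (rather
-- than the carrier itself) are what make cancellations such as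
-- (1 - x) + x ≈ 1 decidable on normal forms.
module IntegerRingSolver {c ℓ} (R : CommutativeRing c ℓ) where
  open CommutativeRing R
  open import Relation.Binary.Reasoning.Setoid setoid
  open import Algebra.Properties.Ring ring
    using (-1*x≈-x; -‿involutive; -0#≈0#; -‿+-comm)
  open import Algebra.Properties.Semiring.Mult.TCOptimised semiring
    using (1+×; ×-homo-+; ×1-homo-*) renaming (_×_ to _·_)

  fromℕ : ℕ → Carrier
  fromℕ n = n · 1#

  fromℤ : ℤ → Carrier
  fromℤ (+ n)      = fromℕ n
  fromℤ -[1+ n ]  = - fromℕ (suc n)

  -- fromℤ is a ring homomorphism; only its existence matters to the solver.
  private
    1+-cancel : ∀ a b → (1# + a) - (1# + b) ≈ a - b
    1+-cancel a b = begin
      (1# + a) + - (1# + b)    ≈⟨ +-congˡ (sym (-‿+-comm 1# b)) ⟩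
      (1# + a) + (- 1# + - b)  ≈⟨ +-assoc _ _ _ ⟩
      1# + (a + (- 1# + - b))  ≈⟨ +-congˡ (sym (+-assoc _ _ _)) ⟩
      1# + ((a + - 1#) + - b)  ≈⟨ +-congˡ (+-congʳ (+-comm _ _)) ⟩
      1# + ((- 1# + a) + - b)  ≈⟨ +-congˡ (+-assoc _ _ _) ⟩
      1# + (- 1# + (a + - b))  ≈⟨ sym (+-assoc _ _ _) ⟩
      (1# + - 1#) + (a + - b)  ≈⟨ +-congʳ (-‿inverseʳ 1#) ⟩
      0# + (a + - b)           ≈⟨ +-identityˡ _ ⟩
      a - b                    ∎

    ⊖-homo : ∀ m n → fromℤ (m ℤ.⊖ n) ≈ fromℕ m - fromℕ n
    ⊖-homo zero    zero    = sym (trans (+-identityˡ _) -0#≈0#)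
    ⊖-homo zero    (suc n) = sym (+-identityˡ _)
    ⊖-homo (suc m) zero    = sym (trans (+-congˡ -0#≈0#) (+-identityʳ _))
    ⊖-homo (suc m) (suc n) = begin
      fromℤ (suc m ℤ.⊖ suc n)          ≡⟨ P.cong fromℤ (ℤP.[1+m]⊖[1+n]≡m⊖n m n) ⟩
      fromℤ (m ℤ.⊖ n)                  ≈⟨ ⊖-homo m n ⟩
      fromℕ m - fromℕ n                ≈⟨ 1+-cancel _ _ ⟨
      (1# + fromℕ m) - (1# + fromℕ n)  ≈⟨ +-cong (1+× m 1#) (-‿cong (1+× n 1#)) ⟨
      fromℕ (suc m) - fromℕ (suc n)    ∎

    -‿homo : ∀ i → fromℤ (ℤ.- i) ≈ - fromℤ i
    -‿homo -[1+ n ] = sym (-‿involutive _)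
    -‿homo +0       = sym -0#≈0#
    -‿homo +[1+ n ] = refl

    +-homo : ∀ i j → fromℤ (i ℤ.+ j) ≈ fromℤ i + fromℤ j
    +-homo -[1+ m ] -[1+ n ] = begin
      - fromℕ (suc (suc (m ℕ.+ n)))                ≈⟨ -‿cong (1+× (suc (m ℕ.+ n)) 1#) ⟩
      - (1# + fromℕ (suc (m ℕ.+ n)))               ≡⟨ P.cong (λ k → - (1# + fromℕ k)) (P.sym (ℕP.+-suc m n)) ⟩
      - (1# + fromℕ (m ℕ.+ suc n))                 ≈⟨ -‿cong (+-congˡ (×-homo-+ 1# m (suc n))) ⟩
      - (1# + (fromℕ m + fromℕ (suc n)))           ≈⟨ -‿cong (sym (+-assoc _ _ _)) ⟩
      - ((1# + fromℕ m) + fromℕ (suc n))           ≈⟨ -‿cong (+-congʳ (1+× m 1#)) ⟨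
      - (fromℕ (suc m) + fromℕ (suc n))            ≈⟨ -‿+-comm _ _ ⟨
      - fromℕ (suc m) + - fromℕ (suc n)            ∎
    +-homo -[1+ m ] (+ n)    = trans (⊖-homo n (suc m)) (+-comm _ _)
    +-homo (+ m)    -[1+ n ] = ⊖-homo m (suc n)
    +-homo (+ m)    (+ n)    = ×-homo-+ 1# m n

    fromSign : Sign → Carrier
    fromSign Sign.+ = 1#
    fromSign Sign.- = - 1#

    ◃-homo : ∀ s n → fromℤ (s ◃ n) ≈ fromSign s * fromℕ n
    ◃-homo Sign.- zero    = sym (zeroʳ _)
    ◃-homo Sign.+ zero    = sym (zeroʳ _)
    ◃-homo Sign.- (suc n) = sym (-1*x≈-x _)
    ◃-homo Sign.+ (suc n) = sym (*-identityˡ _)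

    sign-abs : ∀ i → fromℤ i ≈ fromSign (sign i) * fromℕ ∣ i ∣
    sign-abs -[1+ n ] = sym (-1*x≈-x _)
    sign-abs (+ n)    = sym (*-identityˡ _)

    sign-*-homo : ∀ s t → fromSign (s Sign.* t) ≈ fromSign s * fromSign t
    sign-*-homo Sign.- Sign.- = sym (trans (-1*x≈-x _) (-‿involutive _))
    sign-*-homo Sign.- Sign.+ = sym (*-identityʳ _)
    sign-*-homo Sign.+ Sign.- = sym (*-identityˡ _)
    sign-*-homo Sign.+ Sign.+ = sym (*-identityˡ _)

    *-interchange : ∀ a b x y → (a * b) * (x * y) ≈ (a * x) * (b * y)
    *-interchange a b x y = begin
      (a * b) * (x * y)  ≈⟨ *-assoc _ _ _ ⟩
      a * (b * (x * y))  ≈⟨ *-congˡ (*-assoc _ _ _) ⟨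
      a * ((b * x) * y)  ≈⟨ *-congˡ (*-congʳ (*-comm _ _)) ⟩
      a * ((x * b) * y)  ≈⟨ *-congˡ (*-assoc _ _ _) ⟩
      a * (x * (b * y))  ≈⟨ *-assoc _ _ _ ⟨
      (a * x) * (b * y)  ∎

    *-homo : ∀ i j → fromℤ (i ℤ.* j) ≈ fromℤ i * fromℤ j
    *-homo i j = begin
      fromℤ (i ℤ.* j)
        ≈⟨ ◃-homo (sign i Sign.* sign j) (∣ i ∣ ℕ.* ∣ j ∣) ⟩
      fromSign (sign i Sign.* sign j) * fromℕ (∣ i ∣ ℕ.* ∣ j ∣)
        ≈⟨ *-cong (sign-*-homo (sign i) (sign j)) (×1-homo-* ∣ i ∣ ∣ j ∣) ⟩
      (fromSign (sign i) * fromSign (sign j)) * (fromℕ ∣ i ∣ * fromℕ ∣ j ∣)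
        ≈⟨ *-interchange _ _ _ _ ⟩
      (fromSign (sign i) * fromℕ ∣ i ∣) * (fromSign (sign j) * fromℕ ∣ j ∣)
        ≈⟨ *-cong (sign-abs i) (sign-abs j) ⟨
      fromℤ i * fromℤ j ∎

    ℤ-rawRing : RawRing _ _
    ℤ-rawRing = record
      { Carrier = ℤ ; _≈_ = _≡_ ; _+_ = ℤ._+_ ; _*_ = ℤ._*_ ; -_ = ℤ.-_
      ; 0# = +0 ; 1# = + 1 }

    fromℤ-morphism : ACR._-Raw-AlmostCommutative⟶_ ℤ-rawRing (ACR.fromCommutativeRing R)
    fromℤ-morphism = record
      { ⟦_⟧ = fromℤ ; +-homo = +-homo ; *-homo = *-homo ; -‿homo = -‿homo
      ; 0-homo = refl ; 1-homo = refl }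

    coefficient-test : ∀ i j → Maybe (fromℤ i ≈ fromℤ j)
    coefficient-test i j with i ℤ.≟ j
    ... | yes P.refl = just refl
    ... | no _       = nothing

  open import Algebra.Solver.Ring ℤ-rawRing (ACR.fromCommutativeRing R) fromℤ-morphism coefficient-test public

  𝟘 𝟙 : ∀ {n} → Polynomial n
  𝟘 = con (+ 0)
  𝟙 = con (+ 1)

module FieldFacts {c ℓ} (F : Field c ℓ) where
  open Field F
  open FieldDefs F
  open IntegerRingSolver commutativeRing using (solve; _:=_; _:+_; _:*_)
  open import Relation.Binary.Reasoning.Setoid setoid

  ^-cong : ∀ {x y} n → x ≈ y → x ^ n ≈ y ^ n
  ^-cong zero    e = refl
  ^-cong (suc n) e = *-cong (^-cong n e) e

  ^-+ : ∀ x m n → x ^ (m ℕ.+ n) ≈ x ^ m * x ^ n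
  ^-+ x m zero    = trans (reflexive (P.cong (x ^_) (ℕP.+-identityʳ m))) (sym (*-identityʳ _))
  ^-+ x m (suc n) = begin
    x ^ (m ℕ.+ suc n)      ≡⟨ P.cong (x ^_) (ℕP.+-suc m n) ⟩
    x ^ (m ℕ.+ n) * x      ≈⟨ *-congʳ (^-+ x m n) ⟩
    (x ^ m * x ^ n) * x    ≈⟨ *-assoc _ _ _ ⟩
    x ^ m * (x ^ n * x)    ∎

  *-^ : ∀ x y n → (x * y) ^ n ≈ x ^ n * y ^ n
  *-^ x y zero    = sym (*-identityʳ _)
  *-^ x y (suc n) = begin
    (x * y) ^ n * (x * y)          ≈⟨ *-congʳ (*-^ x y n) ⟩
    (x ^ n * y ^ n) * (x * y)      ≈⟨ solve 4 (λ a b u v → (a :* b) :* (u :* v) := (a :* u) :* (b :* v)) refl _ _ _ _ ⟩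
    (x ^ n * x) * (y ^ n * y)      ∎

  ^-* : ∀ x m n → x ^ (m ℕ.* n) ≈ (x ^ m) ^ n
  ^-* x m zero    = reflexive (P.cong (x ^_) (ℕP.*-zeroʳ m))
  ^-* x m (suc n) = begin
    x ^ (m ℕ.* suc n)            ≡⟨ P.cong (x ^_) (P.trans (ℕP.*-suc m n) (ℕP.+-comm m (m ℕ.* n))) ⟩
    x ^ (m ℕ.* n ℕ.+ m)          ≈⟨ ^-+ x (m ℕ.* n) m ⟩
    x ^ (m ℕ.* n) * x ^ m        ≈⟨ *-congʳ (^-* x m n) ⟩
    (x ^ m) ^ n * x ^ m          ∎

  1^ : ∀ n → 1# ^ n ≈ 1#
  1^ zero    = refl
  1^ (suc n) = trans (*-identityʳ _) (1^ n)

  Σ-cong : ∀ N {f g : ℕ → Carrier} → (∀ k → k < N → f k ≈ g k) → Σ< N f ≈ Σ< N g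
  Σ-cong zero    h = refl
  Σ-cong (suc N) h = +-cong (Σ-cong N (λ k k<N → h k (ℕP.m<n⇒m<1+n k<N))) (h N ℕP.≤-refl)

  Σ-+ : ∀ N (f g : ℕ → Carrier) → Σ< N (λ k → f k + g k) ≈ Σ< N f + Σ< N g
  Σ-+ zero    f g = sym (+-identityʳ _)
  Σ-+ (suc N) f g = trans (+-congʳ (Σ-+ N f g))
    (solve 4 (λ a b x y → (a :+ b) :+ (x :+ y) := (a :+ x) :+ (b :+ y)) refl _ _ _ _)

  Σ-*ˡ : ∀ N a (f : ℕ → Carrier) → a * Σ< N f ≈ Σ< N (λ k → a * f k)
  Σ-*ˡ zero    a f = zeroʳ _
  Σ-*ˡ (suc N) a f = trans (distribˡ _ _ _) (+-congʳ (Σ-*ˡ N a f))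

  Σ-shift : ∀ N (f : ℕ → Carrier) → Σ< (suc N) f ≈ f 0 + Σ< N (λ k → f (suc k))
  Σ-shift zero    f = trans (+-identityˡ _) (sym (+-identityʳ _))
  Σ-shift (suc N) f = trans (+-congʳ (Σ-shift N f)) (+-assoc _ _ _)

  annihilated : ∀ {z} a b → z ≈ 0# → z * a ≈ z * b
  annihilated a b z≈0 = trans (*-congʳ z≈0) (trans (zeroˡ a) (sym (trans (*-congʳ z≈0) (zeroˡ b))))

  *-nonzero : ∀ {x y} → ¬ (x ≈ 0#) → ¬ (y ≈ 0#) → ¬ (x * y ≈ 0#)
  *-nonzero {x} {y} x≉0 y≉0 xy≈0 = y≉0 (begin
    y                  ≈⟨ *-identityˡ _ ⟨
    1# * y             ≈⟨ *-congʳ (trans (*-comm _ _) (⁻¹-inverse x x≉0)) ⟨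
    (x ⁻¹ * x) * y     ≈⟨ *-assoc _ _ _ ⟩
    x ⁻¹ * (x * y)     ≈⟨ *-congˡ xy≈0 ⟩
    x ⁻¹ * 0#          ≈⟨ zeroʳ _ ⟩
    0#                 ∎)

  nonzero-factorʳ : ∀ {x y} → ¬ (x * y ≈ 0#) → ¬ (y ≈ 0#)
  nonzero-factorʳ xy≉0 y≈0 = xy≉0 (trans (*-congˡ y≈0) (zeroʳ _))

  ⁻¹-inverseˡ : ∀ x → ¬ (x ≈ 0#) → x ⁻¹ * x ≈ 1#
  ⁻¹-inverseˡ x x≉0 = trans (*-comm _ _) (⁻¹-inverse x x≉0)

  *-cancelʳ : ∀ {x y z} → ¬ (z ≈ 0#) → x * z ≈ y * z → x ≈ y
  *-cancelʳ {x} {y} {z} z≉0 xz≈yz = begin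
    x                ≈⟨ *-identityʳ _ ⟨
    x * 1#           ≈⟨ *-congˡ (⁻¹-inverse z z≉0) ⟨
    x * (z * z ⁻¹)   ≈⟨ *-assoc _ _ _ ⟨
    (x * z) * z ⁻¹   ≈⟨ *-congʳ xz≈yz ⟩
    (y * z) * z ⁻¹   ≈⟨ *-assoc _ _ _ ⟩
    y * (z * z ⁻¹)   ≈⟨ *-congˡ (⁻¹-inverse z z≉0) ⟩
    y * 1#           ≈⟨ *-identityʳ _ ⟩
    y                ∎

  ⁻¹-split : ∀ d d₁ d₂ g → ¬ (d ≈ 0#) → ¬ (d₁ ≈ 0#) → ¬ (d₂ ≈ 0#) →
             d ≈ d₁ * d₂ * g → d ⁻¹ * g ≈ d₁ ⁻¹ * d₂ ⁻¹
  ⁻¹-split d d₁ d₂ g d≉0 d₁≉0 d₂≉0 d≈ = begin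
    d ⁻¹ * g
      ≈⟨ *-identityʳ _ ⟨
    (d ⁻¹ * g) * 1#
      ≈⟨ *-congˡ (trans (*-cong (⁻¹-inverse d₁ d₁≉0) (⁻¹-inverse d₂ d₂≉0)) (*-identityʳ 1#)) ⟨
    (d ⁻¹ * g) * ((d₁ * d₁ ⁻¹) * (d₂ * d₂ ⁻¹))
      ≈⟨ solve 6 (λ i g d₁ d₂ e₁ e₂ → (i :* g) :* ((d₁ :* e₁) :* (d₂ :* e₂))
                                     := (i :* (d₁ :* d₂ :* g)) :* (e₁ :* e₂)) refl _ _ _ _ _ _ ⟩
    (d ⁻¹ * (d₁ * d₂ * g)) * (d₁ ⁻¹ * d₂ ⁻¹)
      ≈⟨ *-congʳ (*-congˡ d≈) ⟨
    (d ⁻¹ * d) * (d₁ ⁻¹ * d₂ ⁻¹)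
      ≈⟨ *-congʳ (⁻¹-inverseˡ d d≉0) ⟩
    1# * (d₁ ⁻¹ * d₂ ⁻¹)
      ≈⟨ *-identityˡ _ ⟩
    d₁ ⁻¹ * d₂ ⁻¹ ∎

module Pochhammer {c ℓ} (F : Field c ℓ) (q : Field.Carrier F) where
  open Field F
  open FieldDefs F
  open FieldFacts F
  open IntegerRingSolver commutativeRing using (solve; _:=_; _:*_; _:-_; 𝟙)
  open import Relation.Binary.Reasoning.Setoid setoid

  Q : ℕ → Carrier
  Q n = poch q q n

  poch-cong : ∀ {z z'} n → z ≈ z' → poch z q n ≈ poch z' q n
  poch-cong zero    e = refl
  poch-cong (suc n) e = *-cong (poch-cong n e) (+-congˡ (-‿cong (*-congʳ e)))

  poch-∸ : ∀ z {s k} → s ≤ k → poch z q (s ∸ k) ≈ 1#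
  poch-∸ z s≤k = reflexive (P.cong (poch z q) (ℕP.m≤n⇒m∸n≡0 s≤k))

  poch-+ : ∀ z m n → poch z q (m ℕ.+ n) ≈ poch z q m * poch (z * q ^ m) q n
  poch-+ z m zero    = trans (reflexive (P.cong (poch z q) (ℕP.+-identityʳ m))) (sym (*-identityʳ _))
  poch-+ z m (suc n) = begin
    poch z q (m ℕ.+ suc n)
      ≡⟨ P.cong (poch z q) (ℕP.+-suc m n) ⟩
    poch z q (m ℕ.+ n) * (1# - z * q ^ (m ℕ.+ n))
      ≈⟨ *-cong (poch-+ z m n) (+-congˡ (-‿cong (*-congˡ (^-+ q m n)))) ⟩
    (poch z q m * poch (z * q ^ m) q n) * (1# - z * (q ^ m * q ^ n))
      ≈⟨ solve 5 (λ a b z x y → (a :* b) :* (𝟙 :- z :* (x :* y))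
                               := a :* (b :* (𝟙 :- (z :* x) :* y))) refl _ _ _ _ _ ⟩
    poch z q m * (poch (z * q ^ m) q n * (1# - (z * q ^ m) * q ^ n)) ∎

  poch-split : ∀ z {k s} → k ≤ s → poch z q k * poch (z * q ^ k) q (s ∸ k) ≈ poch z q s
  poch-split z {k} {s} k≤s = trans (sym (poch-+ z k (s ∸ k))) (reflexive (P.cong (poch z q) (ℕP.m+[n∸m]≡n k≤s)))

  -- The difference behind every Pascal-type step below:
  -- (zq; q)_{1+s} - (z; q)_{1+s} = z (1 - q^{1+s}) (zq; q)_s.
  poch-shift-difference : ∀ z s →
    poch (z * q) q (suc s) - poch z q (suc s) ≈ z * (1# - q ^ suc s) * poch (z * q) q s
  poch-shift-difference z s = begin
    poch (z * q) q s * (1# - (z * q) * q ^ s) - poch z q (suc s)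
      ≈⟨ +-congˡ (-‿cong first-factor) ⟩
    poch (z * q) q s * (1# - (z * q) * q ^ s) - (1# - z) * poch (z * q) q s
      ≈⟨ solve 4 (λ p z q qs → p :* (𝟙 :- (z :* q) :* qs) :- (𝟙 :- z) :* p
                              := z :* (𝟙 :- qs :* q) :* p) refl _ _ _ _ ⟩
    z * (1# - q ^ s * q) * poch (z * q) q s ∎
    where
    first-factor : poch z q (suc s) ≈ (1# - z) * poch (z * q) q s
    first-factor = begin
      poch z q (1 ℕ.+ s)                     ≈⟨ poch-+ z 1 s ⟩
      poch z q 1 * poch (z * (1# * q)) q s
        ≈⟨ *-cong (trans (*-identityˡ _) (+-congˡ (-‿cong (*-identityʳ _))))
                  (poch-cong s (*-congˡ (*-identityˡ _))) ⟩
      (1# - z) * poch (z * q) q s            ∎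

  -- The q-falling factorial ⟨s⟩_k = (1 - q^s)(1 - q^{s-1})⋯(1 - q^{s-k+1})
  -- = (q; q)_s / (q; q)_{s-k}; it vanishes as soon as k > s.
  falling : ℕ → ℕ → Carrier
  falling s zero    = 1#
  falling s (suc k) = falling s k * (1# - q ^ (s ∸ k))

  falling-vanishes : ∀ s k → s < k → falling s k ≈ 0#
  falling-vanishes s (suc k) (s≤s s≤k) = begin
    falling s k * (1# - q ^ (s ∸ k))   ≡⟨ P.cong (λ e → falling s k * (1# - q ^ e)) (ℕP.m≤n⇒m∸n≡0 s≤k) ⟩
    falling s k * (1# - 1#)            ≈⟨ *-congˡ (-‿inverseʳ 1#) ⟩
    falling s k * 0#                   ≈⟨ zeroʳ _ ⟩
    0#                                 ∎

  Q-falling : ∀ s k → k ≤ s → Q s ≈ Q (s ∸ k) * falling s k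
  Q-falling s zero    _   = sym (*-identityʳ _)
  Q-falling s (suc k) k<s = begin
    Q s                               ≈⟨ Q-falling s k (ℕP.<⇒≤ k<s) ⟩
    Q (s ∸ k) * falling s k           ≡⟨ P.cong (λ e → Q e * falling s k) (ℕP.+-∸-assoc 1 k<s) ⟩
    Q (suc t) * falling s k
      ≈⟨ solve 4 (λ a b q qt → (a :* (𝟙 :- q :* qt)) :* b := a :* (b :* (𝟙 :- qt :* q))) refl _ _ _ _ ⟩
    Q t * (falling s k * (1# - q ^ suc t))
      ≡⟨ P.cong (λ e → Q t * (falling s k * (1# - q ^ e))) (P.sym (ℕP.+-∸-assoc 1 k<s)) ⟩
    Q (s ∸ suc k) * falling s (suc k) ∎
    where t = s ∸ suc k

module GaussianBinomial {c ℓ} (F : Field c ℓ) (q : Field.Carrier F)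
       (Q≉0 : ∀ m → ¬ (Field._≈_ F (FieldDefs.poch F q q m) (Field.0# F))) where
  open Field F
  open FieldDefs F
  open FieldFacts F
  open Pochhammer F q
  open IntegerRingSolver commutativeRing using (solve; _:=_; _:+_; _:*_; _:-_; 𝟙)
  open import Relation.Binary.Reasoning.Setoid setoid

  gauss : ℕ → ℕ → Carrier
  gauss N       zero    = 1#
  gauss zero    (suc k) = 0#
  gauss (suc N) (suc k) = gauss N k + q ^ suc k * gauss N (suc k)

  gauss-vanishes : ∀ N k → N < k → gauss N k ≈ 0#
  gauss-vanishes zero    (suc k) _         = refl
  gauss-vanishes (suc N) (suc k) (s≤s N<k) = begin
    gauss N k + q ^ suc k * gauss N (suc k)
      ≈⟨ +-cong (gauss-vanishes N k N<k) (*-congˡ (gauss-vanishes N (suc k) (ℕP.m<n⇒m<1+n N<k))) ⟩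
    0# + q ^ suc k * 0#
      ≈⟨ trans (+-identityˡ _) (zeroʳ _) ⟩
    0# ∎

  gauss-diagonal : ∀ N → gauss N N ≈ 1#
  gauss-diagonal zero    = refl
  gauss-diagonal (suc N) = begin
    gauss N N + q ^ suc N * gauss N (suc N)
      ≈⟨ +-cong (gauss-diagonal N) (*-congˡ (gauss-vanishes N (suc N) ℕP.≤-refl)) ⟩
    1# + q ^ suc N * 0#
      ≈⟨ trans (+-congˡ (zeroʳ _)) (+-identityʳ _) ⟩
    1#                                       ∎

  gauss-closed : ∀ N k → k ≤ N → gauss N k * (Q k * Q (N ∸ k)) ≈ Q N
  gauss-closed N zero _ = trans (*-identityˡ _) (*-identityˡ _)
  gauss-closed (suc N) (suc k) (s≤s k≤N) with ℕP.m≤n⇒m<n∨m≡n k≤N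
  ... | inj₂ P.refl = begin
    gauss (suc k) (suc k) * (Q (suc k) * Q (k ∸ k))
      ≈⟨ *-cong (gauss-diagonal (suc k)) (*-congˡ (reflexive (P.cong Q (ℕP.n∸n≡0 k)))) ⟩
    1# * (Q (suc k) * 1#)
      ≈⟨ trans (*-identityˡ _) (*-identityʳ _) ⟩
    Q (suc k) ∎
  ... | inj₁ k<N = begin
    (gauss N k + q ^ suc k * gauss N (suc k)) * (Q (suc k) * Q (N ∸ k))
      ≡⟨ P.cong (λ e → (gauss N k + q ^ suc k * gauss N (suc k)) * (Q (suc k) * Q e)) (ℕP.+-∸-assoc 1 k<N) ⟩
    (gauss N k + q ^ suc k * gauss N (suc k)) * (Q (suc k) * Q (suc t))
      ≈⟨ solve 7 (λ b₁ b₂ Qk qq qk Qt qt →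
           (b₁ :+ qk :* qq :* b₂) :* ((Qk :* (𝟙 :- qq :* qk)) :* (Qt :* (𝟙 :- qq :* qt)))
           := (b₁ :* (Qk :* (Qt :* (𝟙 :- qq :* qt)))) :* (𝟙 :- qq :* qk)
              :+ (qk :* qq) :* (b₂ :* ((Qk :* (𝟙 :- qq :* qk)) :* Qt)) :* (𝟙 :- qq :* qt))
           refl _ _ _ _ _ _ _ ⟩
    (gauss N k * (Q k * Q (suc t))) * (1# - q * q ^ k)
      + (q ^ k * q) * (gauss N (suc k) * (Q (suc k) * Q t)) * (1# - q * q ^ t)
      ≡⟨ P.cong (λ e → (gauss N k * (Q k * Q e)) * (1# - q * q ^ k)
                        + (q ^ k * q) * (gauss N (suc k) * (Q (suc k) * Q t)) * (1# - q * q ^ t))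
                (P.sym (ℕP.+-∸-assoc 1 k<N)) ⟩
    (gauss N k * (Q k * Q (N ∸ k))) * (1# - q * q ^ k)
      + (q ^ k * q) * (gauss N (suc k) * (Q (suc k) * Q t)) * (1# - q * q ^ t)
      ≈⟨ +-cong (*-congʳ (gauss-closed N k k≤N)) (*-congʳ (*-congˡ (gauss-closed N (suc k) k<N))) ⟩
    Q N * (1# - q * q ^ k) + (q ^ k * q) * Q N * (1# - q * q ^ t)
      ≈⟨ solve 4 (λ QN qq qk qt → QN :* (𝟙 :- qq :* qk) :+ (qk :* qq) :* QN :* (𝟙 :- qq :* qt)
                                 := QN :* (𝟙 :- qq :* (qk :* qq :* qt))) refl _ _ _ _ ⟩
    Q N * (1# - q * (q ^ suc k * q ^ t))
      ≈⟨ *-congˡ (+-congˡ (-‿cong (*-congˡ exponents))) ⟩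
    Q N * (1# - q * q ^ N) ∎
    where
    t = N ∸ suc k
    exponents : q ^ suc k * q ^ t ≈ q ^ N
    exponents = trans (sym (^-+ q (suc k) t)) (reflexive (P.cong (q ^_) (ℕP.m+[n∸m]≡n k<N)))

  qbinom≈gauss : ∀ N k → k ≤ N → qbinom q N k ≈ gauss N k
  qbinom≈gauss N k k≤N = begin
    Q N * Z ⁻¹              ≈⟨ *-congʳ (gauss-closed N k k≤N) ⟨
    (gauss N k * Z) * Z ⁻¹  ≈⟨ *-assoc _ _ _ ⟩
    gauss N k * (Z * Z ⁻¹)  ≈⟨ *-congˡ (⁻¹-inverse Z (*-nonzero (Q≉0 k) (Q≉0 (N ∸ k)))) ⟩
    gauss N k * 1#          ≈⟨ *-identityʳ _ ⟩
    gauss N k               ∎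
    where Z = Q k * Q (N ∸ k)

  gauss-ratio : ∀ N k → (1# - q ^ (N ∸ k)) * gauss N k ≈ (1# - q ^ suc k) * gauss N (suc k)
  gauss-ratio N k with ℕP.<-≤-connex k N
  ... | inj₁ k<N = *-cancelʳ (*-nonzero (Q≉0 k) (Q≉0 t)) (begin
    ((1# - q ^ (N ∸ k)) * gauss N k) * (Q k * Q t)
      ≡⟨ P.cong (λ e → ((1# - q ^ e) * gauss N k) * (Q k * Q t)) (ℕP.+-∸-assoc 1 k<N) ⟩
    ((1# - q ^ t * q) * gauss N k) * (Q k * Q t)
      ≈⟨ solve 5 (λ qt qq b Qk Qt → ((𝟙 :- qt :* qq) :* b) :* (Qk :* Qt)
                                   := b :* (Qk :* (Qt :* (𝟙 :- qq :* qt)))) refl _ _ _ _ _ ⟩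
    gauss N k * (Q k * Q (suc t))
      ≡⟨ P.cong (λ e → gauss N k * (Q k * Q e)) (P.sym (ℕP.+-∸-assoc 1 k<N)) ⟩
    gauss N k * (Q k * Q (N ∸ k))
      ≈⟨ gauss-closed N k (ℕP.<⇒≤ k<N) ⟩
    Q N
      ≈⟨ gauss-closed N (suc k) k<N ⟨
    gauss N (suc k) * (Q (suc k) * Q t)
      ≈⟨ solve 5 (λ qk qq b Qk Qt → b :* ((Qk :* (𝟙 :- qq :* qk)) :* Qt)
                                   := ((𝟙 :- qk :* qq) :* b) :* (Qk :* Qt)) refl _ _ _ _ _ ⟩
    ((1# - q ^ suc k) * gauss N (suc k)) * (Q k * Q t) ∎)
    where t = N ∸ suc k
  ... | inj₂ N≤k = begin
    (1# - q ^ (N ∸ k)) * gauss N k        ≡⟨ P.cong (λ e → (1# - q ^ e) * gauss N k) (ℕP.m≤n⇒m∸n≡0 N≤k) ⟩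
    (1# - 1#) * gauss N k                 ≈⟨ trans (*-congʳ (-‿inverseʳ _)) (zeroˡ _) ⟩
    0#                                    ≈⟨ trans (*-congˡ (gauss-vanishes N (suc k) (s≤s N≤k))) (zeroʳ _) ⟨
    (1# - q ^ suc k) * gauss N (suc k)    ∎

  gauss-pascal′ : ∀ N k → gauss (suc N) (suc k) ≈ q ^ (N ∸ k) * gauss N k + gauss N (suc k)
  gauss-pascal′ N k = begin
    gauss N k + q ^ suc k * gauss N (suc k)
      ≈⟨ solve 4 (λ a b c d → b :+ c :* d := (a :* b :+ d) :+ ((𝟙 :- a) :* b :- (𝟙 :- c) :* d))
               refl _ _ _ _ ⟩
    (q ^ (N ∸ k) * gauss N k + gauss N (suc k))
      + ((1# - q ^ (N ∸ k)) * gauss N k - (1# - q ^ suc k) * gauss N (suc k))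
      ≈⟨ +-congˡ (trans (+-congʳ (gauss-ratio N k)) (-‿inverseʳ _)) ⟩
    (q ^ (N ∸ k) * gauss N k + gauss N (suc k)) + 0#
      ≈⟨ +-identityʳ _ ⟩
    q ^ (N ∸ k) * gauss N k + gauss N (suc k) ∎

  -- Summation by parts with the two Pascal rules: a sum weighted by [N+1, k]
  -- becomes a sum weighted by [N, k].  These drive all inductions on N below.
  pascal-sum : ∀ N (U : ℕ → Carrier) →
    Σ< (suc (suc N)) (λ k → gauss (suc N) k * U k)
      ≈ Σ< (suc N) (λ k → gauss N k * (U (suc k) + q ^ k * U k))
  pascal-sum N U = begin
    Σ< (suc (suc N)) (λ k → gauss (suc N) k * U k)
      ≈⟨ Σ-shift (suc N) _ ⟩
    1# * U 0 + Σ< (suc N) (λ k → (gauss N k + q ^ suc k * gauss N (suc k)) * U (suc k))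
      ≈⟨ +-cong (*-identityˡ _) (trans (Σ-cong (suc N) (λ k _ → distribʳ _ _ _)) (Σ-+ (suc N) _ _)) ⟩
    U 0 + (A + Σ< (suc N) g)
      ≈⟨ +-congˡ (+-congˡ (trans (+-congˡ last-vanishes) (+-identityʳ _))) ⟩
    U 0 + (A + Σ< N g)
      ≈⟨ +-congˡ (+-congˡ (Σ-cong N (λ k _ → solve 3 (λ a b c → (a :* b) :* c := b :* (a :* c)) refl _ _ _))) ⟩
    U 0 + (A + Σ< N (λ k → h (suc k)))
      ≈⟨ solve 3 (λ u a s → u :+ (a :+ s) := a :+ (u :+ s)) refl _ _ _ ⟩
    A + (U 0 + Σ< N (λ k → h (suc k)))
      ≈⟨ +-congˡ (+-congʳ (trans (*-identityˡ _) (*-identityˡ _))) ⟨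
    A + (h 0 + Σ< N (λ k → h (suc k)))
      ≈⟨ +-congˡ (Σ-shift N h) ⟨
    A + Σ< (suc N) h
      ≈⟨ trans (Σ-cong (suc N) (λ k _ → distribˡ _ _ _)) (Σ-+ (suc N) _ _) ⟨
    Σ< (suc N) (λ k → gauss N k * (U (suc k) + q ^ k * U k)) ∎
    where
    A = Σ< (suc N) (λ k → gauss N k * U (suc k))
    g h : ℕ → Carrier
    g k = (q ^ suc k * gauss N (suc k)) * U (suc k)
    h k = gauss N k * (q ^ k * U k)
    last-vanishes : g N ≈ 0#
    last-vanishes = trans (*-congʳ (trans (*-congˡ (gauss-vanishes N (suc N) ℕP.≤-refl)) (zeroʳ _))) (zeroˡ _)

  pascal-sum′ : ∀ N (U : ℕ → Carrier) →
    Σ< (suc (suc N)) (λ k → gauss (suc N) k * U k)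
      ≈ Σ< (suc N) (λ k → gauss N k * (U k + q ^ (N ∸ k) * U (suc k)))
  pascal-sum′ N U = begin
    Σ< (suc (suc N)) (λ k → gauss (suc N) k * U k)
      ≈⟨ Σ-shift (suc N) _ ⟩
    1# * U 0 + Σ< (suc N) (λ k → gauss (suc N) (suc k) * U (suc k))
      ≈⟨ +-cong (*-identityˡ _) (Σ-cong (suc N) (λ k _ → *-congʳ (gauss-pascal′ N k))) ⟩
    U 0 + Σ< (suc N) (λ k → (q ^ (N ∸ k) * gauss N k + gauss N (suc k)) * U (suc k))
      ≈⟨ +-congˡ (trans (Σ-cong (suc N) (λ k _ → distribʳ _ _ _)) (Σ-+ (suc N) _ _)) ⟩
    U 0 + (G + Σ< (suc N) (λ k → h (suc k)))
      ≈⟨ solve 3 (λ u a s → u :+ (a :+ s) := (u :+ s) :+ a) refl _ _ _ ⟩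
    (U 0 + Σ< (suc N) (λ k → h (suc k))) + G
      ≈⟨ +-congʳ (trans (Σ-shift (suc N) h) (+-congʳ (*-identityˡ _))) ⟨
    (Σ< (suc N) h + h (suc N)) + G
      ≈⟨ +-congʳ (trans (+-congˡ last-vanishes) (+-identityʳ _)) ⟩
    Σ< (suc N) h + G
      ≈⟨ +-congˡ (Σ-cong (suc N) (λ k _ → solve 3 (λ a b c → (a :* b) :* c := b :* (a :* c)) refl _ _ _)) ⟩
    Σ< (suc N) h + Σ< (suc N) (λ k → gauss N k * (q ^ (N ∸ k) * U (suc k)))
      ≈⟨ trans (Σ-cong (suc N) (λ k _ → distribˡ _ _ _)) (Σ-+ (suc N) _ _) ⟨
    Σ< (suc N) (λ k → gauss N k * (U k + q ^ (N ∸ k) * U (suc k))) ∎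
    where
    G = Σ< (suc N) (λ k → (q ^ (N ∸ k) * gauss N k) * U (suc k))
    h : ℕ → Carrier
    h k = gauss N k * U k
    last-vanishes : h (suc N) ≈ 0#
    last-vanishes = trans (*-congʳ (gauss-vanishes N (suc N) ℕP.≤-refl)) (zeroˡ _)

-- 2·(k + c) = 2c + k + k, i.e. q^{2·binom(k+1,2)} = q^{2·binom(k,2)} q^k q^k
double-choose2-suc : ∀ k c → 2 ℕ.* (k ℕ.+ c) ≡ (2 ℕ.* c ℕ.+ k) ℕ.+ k
double-choose2-suc = ℕSolver.solve-∀

-- Two terminating q-binomial expansions of a Pochhammer symbol of length s,
-- in terms of the falling factorial ⟨s⟩_k:
--   (a q^N; q)_s = Σ_k [N, k] q^{2 binom(k,2)} a^k ⟨s⟩_k (a q^k; q)_{s-k},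
--   (b; q)_s     = Σ_k [N, k] (-b)^k q^{binom(k,2)} ⟨s⟩_k (b q^N; q)_{s-k}.
-- Both are proved by induction on N: a Pascal rule turns the sum for N+1
-- into one for N, after which a three-term relation between neighbouring
-- summands (a consequence of poch-shift-difference) closes the step.
module Expansions {c ℓ} (F : Field c ℓ) (q : Field.Carrier F)
       (Q≉0 : ∀ m → ¬ (Field._≈_ F (FieldDefs.poch F q q m) (Field.0# F)))
       (s : ℕ) where
  open Field F
  open FieldDefs F
  open FieldFacts F
  open Pochhammer F q
  open GaussianBinomial F q Q≉0
  open IntegerRingSolver commutativeRing using (solve; _:=_; _:+_; _:*_; _:-_; :-_; 𝟘; 𝟙)
  open import Relation.Binary.Reasoning.Setoid setoid

  pos-term : Carrier → ℕ → Carrier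
  pos-term a k = q ^ (2 ℕ.* choose2 k) * a ^ k * falling s k * poch (a * q ^ k) q (s ∸ k)

  -- For k ≥ s the Pochhammer factor is empty and ⟨s⟩_{k+1} vanishes.
  pos-term-step-trivial : ∀ a k → s ≤ k → pos-term (a * q) k ≈ pos-term a (suc k) + q ^ k * pos-term a k
  pos-term-step-trivial a k s≤k = begin
    Q2 * (a * q) ^ k * falling s k * poch (a * q * q ^ k) q (s ∸ k)
      ≈⟨ *-cong (*-congʳ (*-congˡ (*-^ a q k))) (poch-∸ _ s≤k) ⟩
    Q2 * (A * qk) * falling s k * 1#
      ≈⟨ solve 4 (λ Q2 A qk fl → Q2 :* (A :* qk) :* fl :* 𝟙 := 𝟘 :+ qk :* (Q2 :* A :* fl :* 𝟙)) refl _ _ _ _ ⟩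
    0# + qk * (Q2 * A * falling s k * 1#)
      ≈⟨ +-cong (sym next-vanishes) (*-congˡ (*-congˡ (sym (poch-∸ _ s≤k)))) ⟩
    pos-term a (suc k) + q ^ k * pos-term a k ∎
    where
    Q2 = q ^ (2 ℕ.* choose2 k)
    A  = a ^ k
    qk = q ^ k
    next-vanishes : pos-term a (suc k) ≈ 0#
    next-vanishes = trans (*-congʳ (trans (*-congˡ (falling-vanishes s (suc k) (s≤s s≤k))) (zeroʳ _))) (zeroˡ _)

  pos-term-step : ∀ a k → pos-term (a * q) k ≈ pos-term a (suc k) + q ^ k * pos-term a k
  pos-term-step a k with ℕP.<-≤-connex k s
  ... | inj₂ s≤k = pos-term-step-trivial a k s≤k
  ... | inj₁ k<s = begin
    Q2 * (a * q) ^ k * falling s k * poch (a * q * q ^ k) q (s ∸ k)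
      ≡⟨ P.cong (λ e → Q2 * (a * q) ^ k * falling s k * poch (a * q * q ^ k) q e) s∸k≡1+t ⟩
    Q2 * (a * q) ^ k * falling s k * poch (a * q * q ^ k) q (suc t)
      ≈⟨ *-cong (*-congʳ (*-congˡ (*-^ a q k)))
                (poch-cong (suc t) (solve 3 (λ a q qk → a :* q :* qk := a :* qk :* q) refl _ _ _)) ⟩
    Q2 * (A * qk) * falling s k * poch (z * q) q (suc t)
      ≈⟨ *-congˡ (trans (solve 2 (λ x y → x := (x :- y) :+ y) refl _ _) (+-congʳ (poch-shift-difference z t))) ⟩
    Q2 * (A * qk) * falling s k * (z * (1# - q ^ suc t) * poch (z * q) q t + poch z q (suc t))
      ≈⟨ solve 8 (λ Q2 a A qk fl x pt p₀ → Q2 :* (A :* qk) :* fl :* ((a :* qk) :* (𝟙 :- x) :* pt :+ p₀)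
                   := Q2 :* qk :* qk :* (A :* a) :* (fl :* (𝟙 :- x)) :* pt :+ qk :* (Q2 :* A :* fl :* p₀))
               refl _ _ _ _ _ _ _ _ ⟩
    Q2 * qk * qk * (A * a) * (falling s k * (1# - q ^ suc t)) * poch (z * q) q t + qk * (Q2 * A * falling s k * poch z q (suc t))
      ≈⟨ +-congʳ (*-cong (*-congʳ (*-congʳ (sym Q2-suc))) (poch-cong t (*-assoc _ _ _))) ⟩
    q ^ (2 ℕ.* choose2 (suc k)) * (A * a) * (falling s k * (1# - q ^ suc t)) * poch (a * q ^ suc k) q t
      + qk * (Q2 * A * falling s k * poch z q (suc t))
      ≡⟨ P.cong (λ e → q ^ (2 ℕ.* choose2 (suc k)) * (A * a) * (falling s k * (1# - q ^ e)) * poch (a * q ^ suc k) q t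
                        + qk * (Q2 * A * falling s k * poch z q e)) (P.sym s∸k≡1+t) ⟩
    pos-term a (suc k) + q ^ k * pos-term a k ∎
    where
    t  = s ∸ suc k
    s∸k≡1+t = ℕP.+-∸-assoc 1 k<s
    Q2 = q ^ (2 ℕ.* choose2 k)
    A  = a ^ k
    qk = q ^ k
    z  = a * qk
    Q2-suc : q ^ (2 ℕ.* choose2 (suc k)) ≈ Q2 * qk * qk
    Q2-suc = begin
      q ^ (2 ℕ.* (k ℕ.+ choose2 k))       ≡⟨ P.cong (q ^_) (double-choose2-suc k (choose2 k)) ⟩
      q ^ ((2 ℕ.* choose2 k ℕ.+ k) ℕ.+ k) ≈⟨ ^-+ q (2 ℕ.* choose2 k ℕ.+ k) k ⟩
      q ^ (2 ℕ.* choose2 k ℕ.+ k) * qk    ≈⟨ *-congʳ (^-+ q (2 ℕ.* choose2 k) k) ⟩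
      Q2 * qk * qk                         ∎

  positive-expansion : ∀ N a → Σ< (suc N) (λ k → gauss N k * pos-term a k) ≈ poch (a * q ^ N) q s
  positive-expansion zero    a = solve 1 (λ p → 𝟘 :+ 𝟙 :* (𝟙 :* 𝟙 :* 𝟙 :* p) := p) refl _
  positive-expansion (suc N) a = begin
    Σ< (suc (suc N)) (λ k → gauss (suc N) k * pos-term a k)
      ≈⟨ pascal-sum N (pos-term a) ⟩
    Σ< (suc N) (λ k → gauss N k * (pos-term a (suc k) + q ^ k * pos-term a k))
      ≈⟨ Σ-cong (suc N) (λ k _ → *-congˡ (sym (pos-term-step a k))) ⟩
    Σ< (suc N) (λ k → gauss N k * pos-term (a * q) k)
      ≈⟨ positive-expansion N (a * q) ⟩
    poch (a * q * q ^ N) q s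
      ≈⟨ poch-cong s (solve 3 (λ a q qN → a :* q :* qN := a :* (qN :* q)) refl _ _ _) ⟩
    poch (a * q ^ suc N) q s ∎

  neg-term : ℕ → Carrier → ℕ → Carrier
  neg-term N b k = (- b) ^ k * q ^ choose2 k * falling s k * poch (b * q ^ N) q (s ∸ k)

  -- For k ≥ s the Pochhammer factors are empty and ⟨s⟩_{k+1} vanishes.
  neg-term-step-trivial : ∀ N b k → s ≤ k →
    neg-term (suc N) b k + q ^ (N ∸ k) * neg-term (suc N) b (suc k) ≈ neg-term N b k
  neg-term-step-trivial N b k s≤k = begin
    neg-term (suc N) b k + q ^ (N ∸ k) * neg-term (suc N) b (suc k)
      ≈⟨ +-cong (*-congˡ (poch-∸ _ s≤k)) (trans (*-congˡ next-vanishes) (zeroʳ _)) ⟩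
    (- b) ^ k * q ^ choose2 k * falling s k * 1# + 0#
      ≈⟨ trans (+-identityʳ _) (*-congˡ (sym (poch-∸ _ s≤k))) ⟩
    neg-term N b k ∎
    where
    next-vanishes : neg-term (suc N) b (suc k) ≈ 0#
    next-vanishes = trans (*-congʳ (trans (*-congˡ (falling-vanishes s (suc k) (s≤s s≤k))) (zeroʳ _))) (zeroˡ _)

  neg-term-step : ∀ N b k → k ≤ N →
    neg-term (suc N) b k + q ^ (N ∸ k) * neg-term (suc N) b (suc k) ≈ neg-term N b k
  neg-term-step N b k k≤N with ℕP.<-≤-connex k s
  ... | inj₂ s≤k = neg-term-step-trivial N b k s≤k
  ... | inj₁ k<s = begin
    neg-term (suc N) b k + q ^ (N ∸ k) * neg-term (suc N) b (suc k)
      ≈⟨ +-cong this-term (*-congˡ next-term) ⟩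
    Bk * Qc * falling s k * (b * (qNk * qk) * (1# - X) * Pt + R₀)
      + qNk * ((Bk * - b) * (qk * Qc) * (falling s k * (1# - X)) * Pt)
      ≈⟨ solve 9 (λ Bk Qc fl b qNk qk X Pt R₀ →
                   Bk :* Qc :* fl :* (b :* (qNk :* qk) :* (𝟙 :- X) :* Pt :+ R₀)
                     :+ qNk :* ((Bk :* (:- b)) :* (qk :* Qc) :* (fl :* (𝟙 :- X)) :* Pt)
                   := Bk :* Qc :* fl :* R₀) refl _ _ _ _ _ _ _ _ _ ⟩
    Bk * Qc * falling s k * R₀
      ≡⟨ P.cong (λ e → Bk * Qc * falling s k * poch cN q e) (P.sym s∸k≡1+t) ⟩
    neg-term N b k ∎
    where
    t   = s ∸ suc k
    s∸k≡1+t = ℕP.+-∸-assoc 1 k<s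
    Bk  = (- b) ^ k
    Qc  = q ^ choose2 k
    qk  = q ^ k
    qNk = q ^ (N ∸ k)
    cN  = b * q ^ N
    X   = q ^ suc t
    Pt  = poch (cN * q) q t
    R₀  = poch cN q (suc t)
    shift : b * q ^ suc N ≈ cN * q
    shift = sym (*-assoc _ _ _)
    split : cN ≈ b * (qNk * qk)
    split = *-congˡ (trans (reflexive (P.cong (q ^_) (P.sym (ℕP.m∸n+n≡m k≤N)))) (^-+ q (N ∸ k) k))
    this-term : neg-term (suc N) b k ≈ Bk * Qc * falling s k * (b * (qNk * qk) * (1# - X) * Pt + R₀)
    this-term = begin
      Bk * Qc * falling s k * poch (b * q ^ suc N) q (s ∸ k)
        ≡⟨ P.cong (λ e → Bk * Qc * falling s k * poch (b * q ^ suc N) q e) s∸k≡1+t ⟩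
      Bk * Qc * falling s k * poch (b * q ^ suc N) q (suc t)
        ≈⟨ *-congˡ (poch-cong (suc t) shift) ⟩
      Bk * Qc * falling s k * poch (cN * q) q (suc t)
        ≈⟨ *-congˡ (trans (solve 2 (λ x y → x := (x :- y) :+ y) refl _ _) (+-congʳ (poch-shift-difference cN t))) ⟩
      Bk * Qc * falling s k * (cN * (1# - X) * Pt + R₀)
        ≈⟨ *-congˡ (+-congʳ (*-congʳ (*-congʳ split))) ⟩
      Bk * Qc * falling s k * (b * (qNk * qk) * (1# - X) * Pt + R₀) ∎
    next-term : neg-term (suc N) b (suc k) ≈ (Bk * - b) * (qk * Qc) * (falling s k * (1# - X)) * Pt
    next-term = begin
      (Bk * - b) * q ^ (k ℕ.+ choose2 k) * (falling s k * (1# - q ^ (s ∸ k))) * poch (b * q ^ suc N) q t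
        ≈⟨ *-cong (*-congʳ (*-congˡ (^-+ q k (choose2 k)))) (poch-cong t shift) ⟩
      (Bk * - b) * (qk * Qc) * (falling s k * (1# - q ^ (s ∸ k))) * Pt
        ≡⟨ P.cong (λ e → (Bk * - b) * (qk * Qc) * (falling s k * (1# - q ^ e)) * Pt) s∸k≡1+t ⟩
      (Bk * - b) * (qk * Qc) * (falling s k * (1# - X)) * Pt ∎

  negative-expansion : ∀ N b → Σ< (suc N) (λ k → gauss N k * neg-term N b k) ≈ poch b q s
  negative-expansion zero    b = trans (solve 1 (λ p → 𝟘 :+ 𝟙 :* (𝟙 :* 𝟙 :* 𝟙 :* p) := p) refl _)
                                       (poch-cong s (*-identityʳ _))
  negative-expansion (suc N) b = begin
    Σ< (suc (suc N)) (λ k → gauss (suc N) k * neg-term (suc N) b k)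
      ≈⟨ pascal-sum′ N (neg-term (suc N) b) ⟩
    Σ< (suc N) (λ k → gauss N k * (neg-term (suc N) b k + q ^ (N ∸ k) * neg-term (suc N) b (suc k)))
      ≈⟨ Σ-cong (suc N) (λ k k<1+N → *-congˡ (neg-term-step N b k (ℕP.≤-pred k<1+N))) ⟩
    Σ< (suc N) (λ k → gauss N k * neg-term N b k)
      ≈⟨ negative-expansion N b ⟩
    poch b q s ∎

  -- The second expansion with b = a q^{-N}, the form used for the negative shift.
  negative-expansion′ : ¬ (q ≈ 0#) → ∀ N a →
    Σ< (suc N) (λ k → gauss N k * (q ^ choose2 k * (q ⁻¹) ^ (N ℕ.* k) * (- a) ^ k * falling s k * poch a q (s ∸ k)))
      ≈ poch (a * (q ⁻¹) ^ N) q s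
  negative-expansion′ q≉0 N a = trans (Σ-cong (suc N) (λ k _ → *-congˡ (summand k))) (negative-expansion N b)
    where
    b = a * (q ⁻¹) ^ N
    b-shift : b * q ^ N ≈ a
    b-shift = begin
      a * (q ⁻¹) ^ N * q ^ N     ≈⟨ *-assoc _ _ _ ⟩
      a * ((q ⁻¹) ^ N * q ^ N)   ≈⟨ *-congˡ (*-^ (q ⁻¹) q N) ⟨
      a * (q ⁻¹ * q) ^ N         ≈⟨ *-congˡ (trans (^-cong N (⁻¹-inverseˡ q q≉0)) (1^ N)) ⟩
      a * 1#                     ≈⟨ *-identityʳ _ ⟩
      a                          ∎
    -b^k : ∀ k → (- b) ^ k ≈ (- a) ^ k * (q ⁻¹) ^ (N ℕ.* k)
    -b^k k = begin
      (- b) ^ k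
        ≈⟨ ^-cong k (solve 2 (λ a r → :- (a :* r) := (:- a) :* r) refl a ((q ⁻¹) ^ N)) ⟩
      (- a * (q ⁻¹) ^ N) ^ k            ≈⟨ *-^ (- a) ((q ⁻¹) ^ N) k ⟩
      (- a) ^ k * ((q ⁻¹) ^ N) ^ k      ≈⟨ *-congˡ (^-* (q ⁻¹) N k) ⟨
      (- a) ^ k * (q ⁻¹) ^ (N ℕ.* k)    ∎
    summand : ∀ k → q ^ choose2 k * (q ⁻¹) ^ (N ℕ.* k) * (- a) ^ k * falling s k * poch a q (s ∸ k) ≈ neg-term N b k
    summand k = begin
      q ^ choose2 k * (q ⁻¹) ^ (N ℕ.* k) * (- a) ^ k * falling s k * poch a q (s ∸ k)
        ≈⟨ solve 5 (λ c i ak f p → c :* i :* ak :* f :* p := (ak :* i) :* c :* f :* p) refl _ _ _ _ _ ⟩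
      ((- a) ^ k * (q ⁻¹) ^ (N ℕ.* k)) * q ^ choose2 k * falling s k * poch a q (s ∸ k)
        ≈⟨ *-cong (*-congʳ (*-congʳ (sym (-b^k k)))) (poch-cong (s ∸ k) (sym b-shift)) ⟩
      neg-term N b k ∎

-- (m - (k - i)) + (n - i) = (m + n) - k, the total degree left over after
-- extracting the monomial x^{k-i} y^i from x^m y^n.
∸-split : ∀ m n k i → i ≤ k → k ∸ i ≤ m → i ≤ n → (m ∸ (k ∸ i)) ℕ.+ (n ∸ i) ≡ (m ℕ.+ n) ∸ k
∸-split m n k i i≤k j≤m i≤n = P.sym (begin
  (m ℕ.+ n) ∸ k                    ≡⟨ P.cong ((m ℕ.+ n) ∸_) (P.sym (ℕP.m∸n+n≡m i≤k)) ⟩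
  (m ℕ.+ n) ∸ ((k ∸ i) ℕ.+ i)      ≡⟨ ℕP.∸-+-assoc (m ℕ.+ n) (k ∸ i) i ⟨
  ((m ℕ.+ n) ∸ (k ∸ i)) ∸ i        ≡⟨ P.cong (_∸ i) (ℕP.+-∸-comm n j≤m) ⟩
  ((m ∸ (k ∸ i)) ℕ.+ n) ∸ i        ≡⟨ ℕP.+-∸-assoc (m ∸ (k ∸ i)) i≤n ⟩
  (m ∸ (k ∸ i)) ℕ.+ (n ∸ i)        ∎)
  where open P.≡-Reasoning

module FallingVandermonde {c ℓ} (F : Field c ℓ) (q : Field.Carrier F)
       (Q≉0 : ∀ m → ¬ (Field._≈_ F (FieldDefs.poch F q q m) (Field.0# F)))
       (m n : ℕ) where
  open Field F
  open FieldDefs F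
  open FieldFacts F
  open Pochhammer F q
  open GaussianBinomial F q Q≉0
  open IntegerRingSolver commutativeRing using (solve; _:=_; _:+_; _:*_; _:-_; 𝟘; 𝟙)
  open import Relation.Binary.Reasoning.Setoid setoid

  vand-term : ℕ → ℕ → Carrier
  vand-term k i = q ^ (i ℕ.* (m ∸ (k ∸ i))) * falling m (k ∸ i) * falling n i

  -- q^i q^{i (m-j-1)} (1 - q^{m-j}) = q^{i (m-j)} (1 - q^{m-j}); for j ≥ m both sides vanish
  exponent-shift : ∀ i j → q ^ i * q ^ (i ℕ.* (m ∸ suc j)) * (1# - q ^ (m ∸ j))
                             ≈ q ^ (i ℕ.* (m ∸ j)) * (1# - q ^ (m ∸ j))
  exponent-shift i j with ℕP.<-≤-connex j m
  ... | inj₁ j<m = begin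
    q ^ i * q ^ (i ℕ.* (m ∸ suc j)) * (1# - q ^ (m ∸ j))  ≈⟨ *-congʳ (^-+ q i _) ⟨
    q ^ (i ℕ.+ i ℕ.* (m ∸ suc j)) * (1# - q ^ (m ∸ j))
      ≡⟨ P.cong (λ e → q ^ e * (1# - q ^ (m ∸ j)))
                (P.trans (P.sym (ℕP.*-suc i (m ∸ suc j))) (P.cong (i ℕ.*_) (P.sym (ℕP.+-∸-assoc 1 j<m)))) ⟩
    q ^ (i ℕ.* (m ∸ j)) * (1# - q ^ (m ∸ j))              ∎
  ... | inj₂ m≤j = begin
    q ^ i * q ^ (i ℕ.* (m ∸ suc j)) * (1# - q ^ (m ∸ j))  ≈⟨ *-congˡ one-minus-one ⟩
    q ^ i * q ^ (i ℕ.* (m ∸ suc j)) * 0#                 ≈⟨ trans (zeroʳ _) (sym (zeroʳ _)) ⟩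
    q ^ (i ℕ.* (m ∸ j)) * 0#                             ≈⟨ *-congˡ one-minus-one ⟨
    q ^ (i ℕ.* (m ∸ j)) * (1# - q ^ (m ∸ j))              ∎
    where
    one-minus-one : 1# - q ^ (m ∸ j) ≈ 0#
    one-minus-one = trans (reflexive (P.cong (λ e → 1# - q ^ e) (ℕP.m≤n⇒m∸n≡0 m≤j))) (-‿inverseʳ 1#)

  vand-term-vanishes : ∀ k i → ¬ (k ∸ i ≤ m) ⊎ ¬ (i ≤ n) → vand-term k i ≈ 0#
  vand-term-vanishes k i (inj₁ j≰m) =
    trans (*-congʳ (trans (*-congˡ (falling-vanishes m (k ∸ i) (ℕP.≰⇒> j≰m))) (zeroʳ _))) (zeroˡ _)
  vand-term-vanishes k i (inj₂ i≰n) = trans (*-congˡ (falling-vanishes n i (ℕP.≰⇒> i≰n))) (zeroʳ _)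

  vand-term-step : ∀ k i → i ≤ k →
    vand-term (suc k) (suc i) + q ^ i * vand-term (suc k) i ≈ vand-term k i * (1# - q ^ ((m ℕ.+ n) ∸ k))
  vand-term-step k i i≤k = begin
    vand-term (suc k) (suc i) + q ^ i * vand-term (suc k) i
      ≡⟨ P.cong (λ e → vand-term (suc k) (suc i) + q ^ i * (q ^ (i ℕ.* (m ∸ e)) * falling m e * falling n i))
                (ℕP.+-∸-assoc 1 i≤k) ⟩
    q ^ (M ℕ.+ i ℕ.* M) * Flm * (Fln * (1# - q ^ N′))
      + q ^ i * (q ^ (i ℕ.* (m ∸ suc j)) * (Flm * (1# - q ^ M)) * Fln)
      ≈⟨ +-congʳ (*-congʳ (*-congʳ (^-+ q M (i ℕ.* M)))) ⟩
    q ^ M * qiM * Flm * (Fln * (1# - q ^ N′))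
      + q ^ i * (q ^ (i ℕ.* (m ∸ suc j)) * (Flm * (1# - q ^ M)) * Fln)
      ≈⟨ solve 8 (λ qM qiM Flm Fln qN′ qi qiM′ qM′ →
                   qM :* qiM :* Flm :* (Fln :* (𝟙 :- qN′)) :+ qi :* (qiM′ :* (Flm :* (𝟙 :- qM′)) :* Fln)
                   := (Flm :* Fln) :* (qM :* qiM :* (𝟙 :- qN′) :+ qi :* qiM′ :* (𝟙 :- qM′)))
               refl _ _ _ _ _ _ _ _ ⟩
    (Flm * Fln) * (q ^ M * qiM * (1# - q ^ N′) + q ^ i * q ^ (i ℕ.* (m ∸ suc j)) * (1# - q ^ M))
      ≈⟨ *-congˡ (+-congˡ (exponent-shift i j)) ⟩
    (Flm * Fln) * (q ^ M * qiM * (1# - q ^ N′) + qiM * (1# - q ^ M))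
      ≈⟨ on-support ⟩
    (Flm * Fln) * (qiM * (1# - q ^ ((m ℕ.+ n) ∸ k)))
      ≈⟨ solve 4 (λ Flm Fln qiM Y → (Flm :* Fln) :* (qiM :* Y) := qiM :* Flm :* Fln :* Y) refl _ _ _ _ ⟩
    vand-term k i * (1# - q ^ ((m ℕ.+ n) ∸ k)) ∎
    where
    j   = k ∸ i
    M   = m ∸ j
    N′  = n ∸ i
    qiM = q ^ (i ℕ.* M)
    Flm = falling m j
    Fln = falling n i
    on-support : (Flm * Fln) * (q ^ M * qiM * (1# - q ^ N′) + qiM * (1# - q ^ M))
                   ≈ (Flm * Fln) * (qiM * (1# - q ^ ((m ℕ.+ n) ∸ k)))
    on-support with j ℕ.≤? m | i ℕ.≤? n
    ... | no j≰m | _      = annihilated _ _ (trans (*-congʳ (falling-vanishes m j (ℕP.≰⇒> j≰m))) (zeroˡ _))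
    ... | yes _  | no i≰n = annihilated _ _ (trans (*-congˡ (falling-vanishes n i (ℕP.≰⇒> i≰n))) (zeroʳ _))
    ... | yes j≤m | yes i≤n = *-congˡ (begin
      q ^ M * qiM * (1# - q ^ N′) + qiM * (1# - q ^ M)
        ≈⟨ solve 3 (λ qM qiM qN′ → qM :* qiM :* (𝟙 :- qN′) :+ qiM :* (𝟙 :- qM)
                                  := qiM :* (𝟙 :- qM :* qN′)) refl _ _ _ ⟩
      qiM * (1# - q ^ M * q ^ N′)
        ≈⟨ *-congˡ (+-congˡ (-‿cong (sym (^-+ q M N′)))) ⟩
      qiM * (1# - q ^ (M ℕ.+ N′))
        ≡⟨ P.cong (λ e → qiM * (1# - q ^ e)) (∸-split m n k i i≤k j≤m i≤n) ⟩
      qiM * (1# - q ^ ((m ℕ.+ n) ∸ k)) ∎)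

  falling-vandermonde : ∀ k → Σ< (suc k) (λ i → gauss k i * vand-term k i) ≈ falling (m ℕ.+ n) k
  falling-vandermonde zero    = solve 0 (𝟘 :+ 𝟙 :* (𝟙 :* 𝟙 :* 𝟙) := 𝟙) refl
  falling-vandermonde (suc k) = begin
    Σ< (suc (suc k)) (λ i → gauss (suc k) i * vand-term (suc k) i)
      ≈⟨ pascal-sum k (vand-term (suc k)) ⟩
    Σ< (suc k) (λ i → gauss k i * (vand-term (suc k) (suc i) + q ^ i * vand-term (suc k) i))
      ≈⟨ Σ-cong (suc k) (λ i i<1+k → trans (*-congˡ (vand-term-step k i (ℕP.≤-pred i<1+k))) (*-comm _ _)) ⟩
    Σ< (suc k) (λ i → (vand-term k i * Y) * gauss k i)
      ≈⟨ Σ-cong (suc k) (λ i _ → solve 3 (λ v y g → (v :* y) :* g := y :* (g :* v)) refl _ _ _) ⟩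
    Σ< (suc k) (λ i → Y * (gauss k i * vand-term k i))
      ≈⟨ Σ-*ˡ (suc k) Y _ ⟨
    Y * Σ< (suc k) (λ i → gauss k i * vand-term k i)
      ≈⟨ *-congˡ (falling-vandermonde k) ⟩
    Y * falling (m ℕ.+ n) k
      ≈⟨ *-comm _ _ ⟩
    falling (m ℕ.+ n) (suc k) ∎
    where Y = 1# - q ^ ((m ℕ.+ n) ∸ k)

module Coefficients {c ℓ} (F : Field c ℓ) (q b c₁ c₂ : Field.Carrier F)
       (Q≉0  : ∀ m → ¬ (Field._≈_ F (FieldDefs.poch F q q m) (Field.0# F)))
       (c₁≉0 : ∀ m → ¬ (Field._≈_ F (FieldDefs.poch F c₁ q m) (Field.0# F)))
       (c₂≉0 : ∀ m → ¬ (Field._≈_ F (FieldDefs.poch F c₂ q m) (Field.0# F))) where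
  open Field F
  open FieldDefs F
  open FieldFacts F
  open Pochhammer F q
  open GaussianBinomial F q Q≉0
  open IntegerRingSolver commutativeRing using (solve; _:=_; _:*_)
  open import Relation.Binary.Reasoning.Setoid setoid

  denom : ℕ → ℕ → Carrier
  denom m n = Q m * Q n * poch c₁ q m * poch c₂ q n

  denom≉0 : ∀ m n → ¬ (denom m n ≈ 0#)
  denom≉0 m n = *-nonzero (*-nonzero (*-nonzero (Q≉0 m) (Q≉0 n)) (c₁≉0 m)) (c₂≉0 n)

  common : ℕ → ℕ → Carrier
  common m n = poch b q (m ℕ.+ n) * denom m n ⁻¹

  lhs-coefficient : ∀ A m n → Φ4 q A b c₁ c₂ m n ≈ common m n * poch A q (m ℕ.+ n)
  lhs-coefficient A m n = solve 3 (λ pa pb d → (pa :* pb) :* d := (pb :* d) :* pa) refl _ _ _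

  rhs-term : ℕ → ℕ → ℕ → (T Aₖ A' : Carrier) → PS
  rhs-term N k i T Aₖ A' =
    (qbinom q N k * qbinom q k i * (poch b q k / (poch c₁ q (k ∸ i) * poch c₂ q i)) * T * Aₖ)
      ·ₚ monoMul (k ∸ i) i (scaleX (q ^ i) (Φ4 q A' (b * (q ^ k)) (c₁ * (q ^ (k ∸ i))) (c₂ * (q ^ i))))

  denom-split : ∀ m n j i → j ≤ m → i ≤ n →
    denom m n ≈ (poch c₁ q j * poch c₂ q i)
                * (Q (m ∸ j) * Q (n ∸ i) * poch (c₁ * q ^ j) q (m ∸ j) * poch (c₂ * q ^ i) q (n ∸ i))
                * (falling m j * falling n i)
  denom-split m n j i j≤m i≤n = begin
    Q m * Q n * poch c₁ q m * poch c₂ q n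
      ≈⟨ *-cong (*-cong (*-cong (Q-falling m j j≤m) (Q-falling n i i≤n)) (sym (poch-split c₁ j≤m)))
                (sym (poch-split c₂ i≤n)) ⟩
    (Q (m ∸ j) * falling m j) * (Q (n ∸ i) * falling n i)
      * (poch c₁ q j * poch (c₁ * q ^ j) q (m ∸ j)) * (poch c₂ q i * poch (c₂ * q ^ i) q (n ∸ i))
      ≈⟨ solve 8 (λ Qm fm Qn fn cj cm ci cn → (Qm :* fm) :* (Qn :* fn) :* (cj :* cm) :* (ci :* cn)
                   := (cj :* ci) :* (Qm :* Qn :* cm :* cn) :* (fm :* fn)) refl _ _ _ _ _ _ _ _ ⟩
    (poch c₁ q j * poch c₂ q i)
      * (Q (m ∸ j) * Q (n ∸ i) * poch (c₁ * q ^ j) q (m ∸ j) * poch (c₂ * q ^ i) q (n ∸ i))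
      * (falling m j * falling n i) ∎

  module V = FallingVandermonde F q Q≉0

  vanishing-summand : ∀ {x y g v} → v ≈ 0# → x * y * (g * v) ≈ 0#
  vanishing-summand v≈0 = trans (*-congˡ (trans (*-congˡ v≈0) (zeroʳ _))) (zeroʳ _)

  rhs-term-coefficient : ∀ N k i → k ≤ N → i ≤ k → ∀ T Aₖ A' m n →
    rhs-term N k i T Aₖ A' m n
      ≈ common m n * (gauss N k * T * Aₖ * poch A' q ((m ℕ.+ n) ∸ k)) * (gauss k i * V.vand-term m n k i)
  rhs-term-coefficient N k i k≤N i≤k T Aₖ A' m n with (k ∸ i) ℕ.≤? m | i ℕ.≤? n
  ... | no j≰m  | _      = trans (zeroʳ _) (sym (vanishing-summand (V.vand-term-vanishes m n k i (inj₁ j≰m))))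
  ... | yes _   | no i≰n = trans (zeroʳ _) (sym (vanishing-summand (V.vand-term-vanishes m n k i (inj₂ i≰n))))
  ... | yes j≤m | yes i≤n = begin
    Cf * ((q ^ i) ^ M * ((poch A' q (M ℕ.+ N′) * poch (b * q ^ k) q (M ℕ.+ N′)) * D₂ ⁻¹))
      ≡⟨ P.cong (λ e → Cf * ((q ^ i) ^ M * ((poch A' q e * poch (b * q ^ k) q e) * D₂ ⁻¹)))
                (∸-split m n k i i≤k j≤m i≤n) ⟩
    Cf * ((q ^ i) ^ M * ((pA * pB) * D₂ ⁻¹))
      ≈⟨ *-cong (*-congʳ (*-congʳ (*-congʳ (*-cong (qbinom≈gauss N k k≤N) (qbinom≈gauss k i i≤k)))))
                (*-congʳ (sym (^-* q i M))) ⟩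
    (gauss N k * gauss k i * (poch b q k * D₁ ⁻¹) * T * Aₖ) * (qiM * ((pA * pB) * D₂ ⁻¹))
      ≈⟨ solve 10 (λ gNk gki pbk e₁ t ak qiM pa pb e₂ →
                    (gNk :* gki :* (pbk :* e₁) :* t :* ak) :* (qiM :* ((pa :* pb) :* e₂))
                    := (pbk :* pb) :* (gNk :* t :* ak :* pa) :* (gki :* qiM) :* (e₁ :* e₂))
                refl _ _ _ _ _ _ _ _ _ _ ⟩
    (poch b q k * pB) * Y * (gauss k i * qiM) * (D₁ ⁻¹ * D₂ ⁻¹)
      ≈⟨ *-cong (*-congʳ (*-congʳ (poch-split b k≤s)))
                (sym (⁻¹-split (denom m n) D₁ D₂ G (denom≉0 m n) D₁≉0 D₂≉0
                               (denom-split m n j i j≤m i≤n))) ⟩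
    poch b q s * Y * (gauss k i * qiM) * (denom m n ⁻¹ * G)
      ≈⟨ solve 7 (λ pb y gki qiM d fm fn → pb :* y :* (gki :* qiM) :* (d :* (fm :* fn))
                                        := pb :* d :* y :* (gki :* (qiM :* fm :* fn))) refl _ _ _ _ _ _ _ ⟩
    common m n * Y * (gauss k i * V.vand-term m n k i) ∎
    where
    s  = m ℕ.+ n
    j  = k ∸ i
    M  = m ∸ j
    N′ = n ∸ i
    Cf = qbinom q N k * qbinom q k i * (poch b q k / (poch c₁ q j * poch c₂ q i)) * T * Aₖ
    Y  = gauss N k * T * Aₖ * poch A' q (s ∸ k)
    D₁ = poch c₁ q j * poch c₂ q i
    D₂ = Q M * Q N′ * poch (c₁ * q ^ j) q M * poch (c₂ * q ^ i) q N′
    G  = falling m j * falling n i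
    pA = poch A' q (s ∸ k)
    pB = poch (b * q ^ k) q (s ∸ k)
    qiM = q ^ (i ℕ.* M)
    k≤s : k ≤ s
    k≤s = P.subst (_≤ s) (ℕP.m∸n+n≡m i≤k) (ℕP.+-mono-≤ j≤m i≤n)
    D₁≉0 : ¬ (D₁ ≈ 0#)
    D₁≉0 = *-nonzero (c₁≉0 j) (c₂≉0 i)
    D₂≉0 : ¬ (D₂ ≈ 0#)
    D₂≉0 = *-nonzero (*-nonzero (*-nonzero (Q≉0 M) (Q≉0 N′))
                                (nonzero-factorʳ (λ e → c₁≉0 m (trans (sym (poch-split c₁ j≤m)) e))))
                     (nonzero-factorʳ (λ e → c₂≉0 n (trans (sym (poch-split c₂ i≤n)) e)))

  -- Summing the (k, i) summands: the inner sum over i collapses by the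
  -- falling q-Vandermonde identity, leaving common m n times an expansion of
  -- the kind established in Expansions.
  rhs-coefficient : ∀ N m n (T Aₖ A' : ℕ → Carrier) L →
    Σ< (suc N) (λ k → gauss N k * (T k * Aₖ k * falling (m ℕ.+ n) k * poch (A' k) q ((m ℕ.+ n) ∸ k))) ≈ L →
    Σ< (suc N) (λ k → Σ< (suc k) (λ i → rhs-term N k i (T k) (Aₖ k) (A' k) m n)) ≈ common m n * L
  rhs-coefficient N m n T Aₖ A' L expansion = begin
    Σ< (suc N) (λ k → Σ< (suc k) (λ i → rhs-term N k i (T k) (Aₖ k) (A' k) m n))
      ≈⟨ Σ-cong (suc N) (λ k k<1+N → Σ-cong (suc k) (λ i i<1+k →
           rhs-term-coefficient N k i (ℕP.≤-pred k<1+N) (ℕP.≤-pred i<1+k) (T k) (Aₖ k) (A' k) m n)) ⟩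
    Σ< (suc N) (λ k → Σ< (suc k) (λ i → common m n * Y k * (gauss k i * V.vand-term m n k i)))
      ≈⟨ Σ-cong (suc N) (λ k _ → sym (Σ-*ˡ (suc k) _ _)) ⟩
    Σ< (suc N) (λ k → common m n * Y k * Σ< (suc k) (λ i → gauss k i * V.vand-term m n k i))
      ≈⟨ Σ-cong (suc N) (λ k _ → *-congˡ (V.falling-vandermonde m n k)) ⟩
    Σ< (suc N) (λ k → common m n * Y k * falling s k)
      ≈⟨ Σ-cong (suc N) (λ k _ → solve 6 (λ cm g t ak pa fl → cm :* (g :* t :* ak :* pa) :* fl
                                                          := cm :* (g :* (t :* ak :* fl :* pa)))
                                         refl _ _ _ _ _ _) ⟩
    Σ< (suc N) (λ k → common m n * (gauss N k * (T k * Aₖ k * falling s k * poch (A' k) q (s ∸ k))))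
      ≈⟨ Σ-*ˡ (suc N) _ _ ⟨
    common m n * Σ< (suc N) (λ k → gauss N k * (T k * Aₖ k * falling s k * poch (A' k) q (s ∸ k)))
      ≈⟨ *-congˡ expansion ⟩
    common m n * L ∎
    where
    s = m ℕ.+ n
    Y : ℕ → Carrier
    Y k = gauss N k * T k * Aₖ k * poch (A' k) q (s ∸ k)

theorem15 : ∀ {ℓ₁ ℓ₂ : Level} (F : Field ℓ₁ ℓ₂) →
    let open Field F in
    let open FieldDefs F in
    (q a b c c' : Carrier) →
    ¬ (q ≈ 0#) →
    (∀ m → ¬ (poch q q m ≈ 0#)) →
    (∀ m → ¬ (poch c q m ≈ 0#)) →
    (∀ m → ¬ (poch c' q m ≈ 0#)) →
    (n : ℕ) → 1 ≤ n →
    (Φ4 q (a * (q ^ n)) b c c'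
      ≈ₚ Σₚ< (suc n) (λ k → Σₚ< (suc k) (λ i →
           ((qbinom q n k * qbinom q k i
              * (poch b q k / (poch c q (k ∸ i) * poch c' q i))
              * (q ^ (2 ℕ.* choose2 k)) * (a ^ k))
            ·ₚ monoMul (k ∸ i) i
                 (scaleX (q ^ i)
                   (Φ4 q (a * (q ^ k)) (b * (q ^ k))
                       (c * (q ^ (k ∸ i))) (c' * (q ^ i))))))))
    ×
    (Φ4 q (a * ((q ⁻¹) ^ n)) b c c'
      ≈ₚ Σₚ< (suc n) (λ k → Σₚ< (suc k) (λ i →
           ((qbinom q n k * qbinom q k i
              * (poch b q k / (poch c q (k ∸ i) * poch c' q i))
              * ((q ^ choose2 k) * ((q ⁻¹) ^ (n ℕ.* k))) * ((- a) ^ k))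
            ·ₚ monoMul (k ∸ i) i
                 (scaleX (q ^ i)
                   (Φ4 q a (b * (q ^ k))
                       (c * (q ^ (k ∸ i))) (c' * (q ^ i))))))))
theorem15 F q a b c c' q≉0 Q≉0 c≉0 c'≉0 N _ =
    (λ m n → trans (lhs-coefficient (a * q ^ N) m n)
                   (sym (rhs-coefficient N m n (λ k → q ^ (2 ℕ.* choose2 k)) (λ k → a ^ k) (λ k → a * q ^ k) _
                                         (E.positive-expansion (m ℕ.+ n) N a))))
  , (λ m n → trans (lhs-coefficient (a * (q ⁻¹) ^ N) m n)
                   (sym (rhs-coefficient N m n (λ k → q ^ choose2 k * (q ⁻¹) ^ (N ℕ.* k))
                                         (λ k → (- a) ^ k) (λ _ → a) _
                                         (E.negative-expansion′ (m ℕ.+ n) q≉0 N a))))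
  where
  open Field F using (_*_; _⁻¹; -_; trans; sym)
  open FieldDefs F using (_^_; choose2)
  open Coefficients F q b c c' Q≉0 c≉0 c'≉0
  module E s = Expansions F q Q≉0 s
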